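{- Let $a\geq 2$ be an integer and let $r=P_a(2a-1)$. Then $$I_{a,a}\geq \frac{r(r+1)}{2}.$$
   Context: $K_{a,a}$ denotes the complete bipartite graph with both partite sets of size $a$. $I_{a,a}$ denotes the number of isomorphism classes (under graph isomorphism) of spanning trees of $K_{a,a}$. For positive integers $k,m$, $P_k(m)$ denotes the number of integer partitions of $m$ into exactly $k$ (positive) parts. -}

module Defs where

open import Data.Nat using (ℕ; zero; suc; _+_; _*_; _∸_; _≤_; _≤ᵇ_; _≡ᵇ_)
open import Data.Nat.DivMod using (_/_)
open import Data.Bool using (Bool; true; false; _∧_; T)
open import Data.Fin using (Fin)
open import Data.Vec using (Vec; []; _∷_)
import Data.Vec as Vec
open import Data.List using (List; []; _∷_; [_]; _++_; length; map; concatMap; upTo; filterᵇ)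
open import Data.List.Relation.Unary.Unique.Propositional using (Unique)
open import Data.Sum using (_⊎_; inj₁; inj₂)
open import Data.Product using (Σ; _×_; ∃; _,_)
open import Relation.Binary.PropositionalEquality using (_≡_)
open import Data.Empty using (⊥)
open import Data.Unit using (⊤)
open import Function.Bundles using (_↔_; Inverse)

-- Integer partitions: P k m = number of partitions of m into exactly k
-- positive parts, i.e. the number of non-increasing length-k sequences of
-- positive integers summing to m (counted by explicit enumeration).

vecsUpTo : (k n : ℕ) → List (Vec ℕ k)
vecsUpTo zero    n = [ [] ]
vecsUpTo (suc k) n = concatMap (λ x → map (x ∷_) (vecsUpTo k n)) (upTo (suc n))

nonIncreasingᵇ : ∀ {k} → Vec ℕ k → Bool
nonIncreasingᵇ []           = true
nonIncreasingᵇ (x ∷ [])     = true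
nonIncreasingᵇ (x ∷ y ∷ xs) = (y ≤ᵇ x) ∧ nonIncreasingᵇ (y ∷ xs)

allPositiveᵇ : ∀ {k} → Vec ℕ k → Bool
allPositiveᵇ []       = true
allPositiveᵇ (x ∷ xs) = (1 ≤ᵇ x) ∧ allPositiveᵇ xs

isPartitionᵇ : (k m : ℕ) → Vec ℕ k → Bool
isPartitionᵇ k m v = nonIncreasingᵇ v ∧ allPositiveᵇ v ∧ (Vec.sum v ≡ᵇ m)

P : (k m : ℕ) → ℕ
P k m = length (filterᵇ (isPartitionᵇ k m) (vecsUpTo k m))

-- Spanning subgraphs of K_{a,a}.  Vertices: Fin a ⊎ Fin a (left/right side).
-- A spanning subgraph is given by its edge set  E i j = true  iff the
-- left vertex i is joined to the right vertex j.

Vtx : ℕ → Set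
Vtx a = Fin a ⊎ Fin a

EdgeSet : ℕ → Set
EdgeSet a = Fin a → Fin a → Bool

Adj : ∀ {a} → EdgeSet a → Vtx a → Vtx a → Set
Adj E (inj₁ i) (inj₂ j) = T (E i j)
Adj E (inj₂ j) (inj₁ i) = T (E i j)
Adj E (inj₁ _) (inj₁ _) = ⊥
Adj E (inj₂ _) (inj₂ _) = ⊥

data Reach {a} (E : EdgeSet a) : Vtx a → Vtx a → Set where
  here : ∀ {u} → Reach E u u
  step : ∀ {u v w} → Adj E u v → Reach E v w → Reach E u w

Connected : ∀ {a} → EdgeSet a → Set
Connected E = ∀ u v → Reach E u v

Chain : ∀ {a} → EdgeSet a → List (Vtx a) → Set
Chain E []           = ⊤
Chain E (x ∷ [])     = ⊤
Chain E (x ∷ y ∷ xs) = Adj E x y × Chain E (y ∷ xs)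

-- a cycle: distinct vertices v, v₁, …, v_k (k ≥ 2, so at least 3 vertices),
-- consecutive ones adjacent and v_k adjacent to v
Acyclic : ∀ {a} → EdgeSet a → Set
Acyclic {a} E = (v : Vtx a) (vs : List (Vtx a)) → 2 ≤ length vs →
  Unique (v ∷ vs) → Chain E (v ∷ vs ++ [ v ]) → ⊥

IsTree : ∀ {a} → EdgeSet a → Set
IsTree E = Connected E × Acyclic E

SpanningTree : ℕ → Set
SpanningTree a = Σ (EdgeSet a) IsTree

-- graph isomorphism of two spanning trees (as graphs on 2a vertices; the
-- bijection need not preserve the bipartition sides)
Isomorphic : ∀ {a} → SpanningTree a → SpanningTree a → Set
Isomorphic {a} (E , _) (F , _) =
  Σ (Vtx a ↔ Vtx a) λ σ →
    ∀ u v → (Adj E u v → Adj F (Inverse.to σ u) (Inverse.to σ v))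
          × (Adj F (Inverse.to σ u) (Inverse.to σ v) → Adj E u v)

-- "I_{a,a} ≥ N": there are N pairwise non-isomorphic spanning trees
AtLeastIsoClasses : ℕ → ℕ → Set
AtLeastIsoClasses a N =
  Σ (Fin N → SpanningTree a) λ t → ∀ i j → Isomorphic (t i) (t j) → i ≡ j

{-# OPTIONS --safe #-}
-- Write offset v i = Σ_{k<i} (v k − 1).  For partitions p, q of 2a − 1 into a parts, tree p q
-- joins left vertex i to the right vertices offset p i + 1, …, offset p (i + 1), right vertex j
-- to the left vertices offset q j + 1, …, offset q (j + 1), and the two vertices 0 to each other.
-- In the order L₀ < R₀ < L₁ < R₁ < ⋯ every vertex except L₀ has exactly one smaller neighbour,
-- so tree p q is a spanning tree, and its left and right degree sequences are p and q.
-- An isomorphism between connected bipartite graphs either preserves or swaps the two sides,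
-- and it preserves degrees; hence isomorphic trees have the same unordered pair {p, q}, and the
-- r (r + 1) / 2 unordered pairs of partitions give pairwise non-isomorphic spanning trees.
module Submission where

open import Defs
open import Data.Bool using (Bool; true; false; not; T; _∧_)
import Data.Bool.Properties as Bool
open import Data.Fin using (Fin; zero; suc; toℕ; fromℕ; fromℕ<; inject≤; inject₁; splitAt; join)
open import Data.Fin.Properties
  using (toℕ-fromℕ; toℕ-fromℕ<; toℕ-inject₁; toℕ-inject≤; toℕ-injective; toℕ<n; fromℕ<-injective;
         inject₁-injective; inject≤-injective; fromℕ≢inject₁; join-splitAt; injective⇒≤; all?; ¬∀⟶∃¬)
open import Data.List as List using (List; []; _∷_; [_]; _++_; filterᵇ; concatMap; upTo; cartesianProductWith)
open import Data.List.Membership.Propositional.Properties using (∈-lookup)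
open import Data.List.Relation.Unary.All as All using (All; []; _∷_)
open import Data.List.Relation.Unary.All.Properties using (all-filter)
open import Data.List.Relation.Unary.AllPairs using ([]; _∷_)
import Data.List.Relation.Unary.AllPairs.Properties as AllPairs
open import Data.List.Relation.Unary.Unique.Propositional using (Unique)
import Data.List.Relation.Unary.Unique.Propositional.Properties as Unique
open import Data.Nat using (ℕ; zero; suc; _+_; _*_; _∸_; _≤_; _<_; z≤n; s≤s; s≤s⁻¹; z<s; s<s)
open import Data.Nat.DivMod using (_/_; m*n/n≡m)
open import Data.Nat.Properties
open import Data.Nat.Solver using (module +-*-Solver)
open import Data.Product as Product using (Σ; _×_; ∃; _,_; proj₁; proj₂)
open import Data.Sum using (_⊎_; inj₁; inj₂; swap; [_,_]′)
open import Data.Sum.Properties using (inj₁-injective; inj₂-injective; swap-↔; swap-involutive)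
open import Data.Unit using (⊤; tt)
open import Data.Vec as Vec using (Vec; []; _∷_)
open import Data.Vec.Properties using (∷-injective)
open import Function using (_∘_)
open import Function.Bundles using (_↣_; mk↣; Injection; Inverse; Equivalence)
open import Function.Construct.Composition using (_↣-∘_; _↔-∘_)
open import Function.Definitions using (Injective)
open import Function.Properties.Inverse using (↔⇒↣; ↔-sym)
open import Relation.Binary.Definitions using (tri<; tri≈; tri>)
open import Relation.Binary.PropositionalEquality
  using (_≡_; _≢_; refl; sym; trans; cong; cong₂; subst; subst₂; ≢-sym; module ≡-Reasoning)
open import Relation.Nullary using (yes; no; Dec)
open import Relation.Nullary.Decidable using (T?; map′; _×-dec_; _⊎-dec_; toWitness; fromWitness; isYes)
open import Relation.Nullary.Negation using (contradiction)

-- Offsets of a partition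

at : ∀ {k} → Vec ℕ k → ℕ → ℕ
at []       _       = 0
at (x ∷ xs) zero    = x
at (x ∷ xs) (suc i) = at xs i

NonIncreasing : ∀ {k} → Vec ℕ k → Set
NonIncreasing v = ∀ i → at v (suc i) ≤ at v i

record IsPartition (k m : ℕ) (v : Vec ℕ k) : Set where
  field
    nonIncreasing : NonIncreasing v
    positive      : ∀ i → i < k → 1 ≤ at v i
    sum≡          : Vec.sum v ≡ m

offset : ∀ {k} → Vec ℕ k → ℕ → ℕ
offset v        zero    = 0
offset []       (suc i) = 0
offset (x ∷ xs) (suc i) = (x ∸ 1) + offset xs i

offset-suc : ∀ {k} (v : Vec ℕ k) i → offset v (suc i) ≡ offset v i + (at v i ∸ 1)
offset-suc []       zero    = refl
offset-suc []       (suc i) = refl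
offset-suc (x ∷ xs) zero    = +-identityʳ (x ∸ 1)
offset-suc (x ∷ xs) (suc i) =
  trans (cong ((x ∸ 1) +_) (offset-suc xs i)) (sym (+-assoc (x ∸ 1) _ _))

offset-mono : ∀ {k} (v : Vec ℕ k) {i j} → i ≤ j → offset v i ≤ offset v j
offset-mono v        {zero}          _   = z≤n
offset-mono []       {suc i} {suc j} _   = z≤n
offset-mono (x ∷ xs) {suc i} {suc j} i≤j = +-monoʳ-≤ (x ∸ 1) (offset-mono xs (s≤s⁻¹ i≤j))

offset+length≡sum : ∀ {k} (v : Vec ℕ k) → (∀ i → i < k → 1 ≤ at v i) → offset v k + k ≡ Vec.sum v
offset+length≡sum []               _   = refl
offset+length≡sum {suc k} (x ∷ xs) pos = begin
  (x ∸ 1) + offset xs k + suc k    ≡⟨ +-suc _ k ⟩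
  suc ((x ∸ 1) + offset xs k + k)  ≡⟨ cong suc (+-assoc (x ∸ 1) _ k) ⟩
  suc (x ∸ 1) + (offset xs k + k)  ≡⟨ cong₂ _+_ (m+[n∸m]≡n (pos 0 z<s)) (offset+length≡sum xs pos′) ⟩
  x + Vec.sum xs                   ∎
  where
    open ≡-Reasoning
    pos′ = λ i i<k → pos (suc i) (s<s i<k)

head≤1⇒offset≡0 : ∀ {k} (v : Vec ℕ k) → NonIncreasing v → at v 0 ≤ 1 → ∀ i → offset v i ≡ 0
head≤1⇒offset≡0 v        _    _   zero    = refl
head≤1⇒offset≡0 []       _    _   (suc i) = refl
head≤1⇒offset≡0 (x ∷ xs) desc x≤1 (suc i) =
  cong₂ _+_ (m≤n⇒m∸n≡0 x≤1) (head≤1⇒offset≡0 xs (desc ∘ suc) (≤-trans (desc 0) x≤1) i)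

≤offset⊎offset-saturated : ∀ {k} (v : Vec ℕ k) → NonIncreasing v →
  ∀ i → i ≤ offset v i ⊎ offset v i ≡ offset v k
≤offset⊎offset-saturated v                _    zero    = inj₁ z≤n
≤offset⊎offset-saturated []               _    (suc i) = inj₂ refl
≤offset⊎offset-saturated {suc k} (x ∷ xs) desc (suc i) with x ≤? 1
... | yes x≤1 = inj₂ (trans (head≤1⇒offset≡0 (x ∷ xs) desc x≤1 (suc i))
                            (sym (head≤1⇒offset≡0 (x ∷ xs) desc x≤1 (suc k))))
... | no  x≰1 with ≤offset⊎offset-saturated xs (desc ∘ suc) i
...   | inj₁ i≤offset  = inj₁ (+-mono-≤ (∸-monoˡ-≤ 1 (≰⇒> x≰1)) i≤offset)
...   | inj₂ saturated = inj₂ (cong ((x ∸ 1) +_) saturated)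

module _ {n : ℕ} {v : Vec ℕ (suc n)} (part : IsPartition (suc n) (2 * suc n ∸ 1) v) where

  offset-total : offset v (suc n) ≡ n
  offset-total = +-cancelʳ-≡ (suc n) _ _ (begin
    offset v (suc n) + suc n  ≡⟨ offset+length≡sum v (IsPartition.positive part) ⟩
    Vec.sum v                 ≡⟨ IsPartition.sum≡ part ⟩
    2 * suc n ∸ 1             ≡⟨ cong (λ m → n + suc m) (+-identityʳ n) ⟩
    n + suc n                 ∎)
    where open ≡-Reasoning

  index≤offset : ∀ {i} → i < suc n → i ≤ offset v i
  index≤offset {i} i<a with ≤offset⊎offset-saturated v (IsPartition.nonIncreasing part) i
  ... | inj₁ i≤offset  = i≤offset
  ... | inj₂ saturated = subst (i ≤_) (sym (trans saturated offset-total)) (s≤s⁻¹ i<a)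

offset-interval : ∀ {k} (v : Vec ℕ k) {j} → 0 < j → j ≤ offset v k →
  ∃ λ i → i < k × offset v i < j × j ≤ offset v (suc i)
offset-interval []       {zero}  () _
offset-interval []       {suc j} _  ()
offset-interval (x ∷ xs) {j} 0<j j≤total with j ≤? x ∸ 1
... | yes j≤x-1 = 0 , z<s , 0<j , ≤-trans j≤x-1 (m≤m+n _ _)
... | no  j≰x-1 with offset-interval xs {j ∸ (x ∸ 1)} (m<n⇒0<n∸m (≰⇒> j≰x-1))
                       (subst (j ∸ (x ∸ 1) ≤_) (m+n∸m≡n (x ∸ 1) _) (∸-monoˡ-≤ (x ∸ 1) j≤total))
...   | i , i<k , below , above =
  suc i , s<s i<k , subst (_ <_) x-1+rest≡j (+-monoʳ-< (x ∸ 1) below)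
                  , subst (_≤ _) x-1+rest≡j (+-monoʳ-≤ (x ∸ 1) above)
  where x-1+rest≡j = m+[n∸m]≡n (<⇒≤ (≰⇒> j≰x-1))

offset-interval-unique : ∀ {k} (v : Vec ℕ k) {i i′ j} →
  offset v i < j → j ≤ offset v (suc i) → offset v i′ < j → j ≤ offset v (suc i′) → i ≡ i′
offset-interval-unique v {i} {i′} below above below′ above′ with <-cmp i i′
... | tri≈ _ i≡i′ _ = i≡i′
... | tri< i<i′ _ _ = contradiction (≤-trans above (offset-mono v i<i′)) (<⇒≱ below′)
... | tri> _ _ i′<i = contradiction (≤-trans above′ (offset-mono v i′<i)) (<⇒≱ below)

-- Comparing sorted sequences

antitone : ∀ {k} {v : Vec ℕ k} → NonIncreasing v → ∀ {i j} → i ≤ j → at v j ≤ at v i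
antitone         desc {j = zero}  z≤n = ≤-refl
antitone {v = v} desc {j = suc j} i≤j with m≤n⇒m<n∨m≡n i≤j
... | inj₁ i<1+j = ≤-trans (desc j) (antitone {v = v} desc (s≤s⁻¹ i<1+j))
... | inj₂ refl  = ≤-refl

Dominated : ∀ {k} → Vec ℕ k → Vec ℕ k → Set
Dominated {k} v w = ∀ m → m < k → at v m ≤ at w m

Dominated-antisym : ∀ {k} {v w : Vec ℕ k} → Dominated v w → Dominated w v → v ≡ w
Dominated-antisym {v = []}     {[]}     _   _   = refl
Dominated-antisym {v = x ∷ xs} {y ∷ ys} v≤w w≤v =
  cong₂ _∷_ (≤-antisym (v≤w 0 z<s) (w≤v 0 z<s))
            (Dominated-antisym (λ m m<k → v≤w (suc m) (s<s m<k)) (λ m m<k → w≤v (suc m) (s<s m<k)))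

injection-reaches : ∀ {k m} (τ : Fin k → Fin k) → Injective _≡_ _≡_ τ → (m<k : m < k) →
  ∃ λ (y : Fin (suc m)) → m ≤ toℕ (τ (inject≤ y m<k))
injection-reaches {k} {m} τ τ-injective m<k with all? (λ y → toℕ (τ (inject≤ y m<k)) <? m)
... | yes below = contradiction (injective⇒≤ squeeze-injective) 1+n≰n
  where
    squeeze : Fin (suc m) → Fin m
    squeeze y = fromℕ< (below y)
    squeeze-injective : Injective _≡_ _≡_ squeeze
    squeeze-injective {x} {y} eq = inject≤-injective m<k m<k x y (τ-injective (toℕ-injective
      (trans (sym (toℕ-fromℕ< (below x))) (trans (cong toℕ eq) (toℕ-fromℕ< (below y))))))
... | no ¬below with ¬∀⟶∃¬ (suc m) _ (λ y → toℕ (τ (inject≤ y m<k)) <? m) ¬below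
...   | y , ¬y-below = y , ≮⇒≥ ¬y-below

dominated-via-injection : ∀ {k} {v w : Vec ℕ k} → NonIncreasing v → NonIncreasing w →
  (τ : Fin k → Fin k) → Injective _≡_ _≡_ τ → (∀ i → at v (toℕ i) ≤ at w (toℕ (τ i))) →
  Dominated v w
dominated-via-injection {v = v} {w} v-desc w-desc τ τ-injective v≤w∘τ m m<k
  with injection-reaches τ τ-injective m<k
... | y , m≤τy = begin
  at v m                          ≤⟨ antitone {v = v} v-desc y≤m ⟩
  at v (toℕ (inject≤ y m<k))      ≤⟨ v≤w∘τ (inject≤ y m<k) ⟩
  at w (toℕ (τ (inject≤ y m<k)))  ≤⟨ antitone {v = w} w-desc m≤τy ⟩
  at w m                          ∎
  where
    open ≤-Reasoning
    y≤m = subst (_≤ m) (sym (toℕ-inject≤ y m<k)) (s≤s⁻¹ (toℕ<n y))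

-- Walks, neighbours and degrees

Adj-sym : ∀ {a} {E : EdgeSet a} u v → Adj E u v → Adj E v u
Adj-sym (inj₁ _) (inj₂ _) uv = uv
Adj-sym (inj₂ _) (inj₁ _) uv = uv

Adj-irrelevant : ∀ {a} {E : EdgeSet a} u v (h h′ : Adj E u v) → h ≡ h′
Adj-irrelevant (inj₁ _) (inj₂ _) h h′ = Bool.T-irrelevant h h′
Adj-irrelevant (inj₂ _) (inj₁ _) h h′ = Bool.T-irrelevant h h′

Reach-trans : ∀ {a} {E : EdgeSet a} {u v w} → Reach E u v → Reach E v w → Reach E u w
Reach-trans here        r′ = r′
Reach-trans (step uv r) r′ = step uv (Reach-trans r r′)

Reach-sym : ∀ {a} {E : EdgeSet a} {u v} → Reach E u v → Reach E v u
Reach-sym here = here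
Reach-sym {E = E} {u} (step {v = w} uw r) =
  Reach-trans (Reach-sym r) (step (Adj-sym {E = E} u w uw) here)

Neighbour : ∀ {a} → EdgeSet a → Vtx a → Set
Neighbour {a} E v = Σ (Vtx a) (Adj E v)

Neighbour-≡ : ∀ {a} {E : EdgeSet a} {v} {x y : Neighbour E v} → proj₁ x ≡ proj₁ y → x ≡ y
Neighbour-≡ {E = E} {v} {u , h} {.u , h′} refl = cong (u ,_) (Adj-irrelevant {E = E} v u h h′)

Preserves : ∀ {a} → EdgeSet a → EdgeSet a → (Vtx a → Vtx a) → Set
Preserves E F s = ∀ u v → Adj E u v → Adj F (s u) (s v)

neighbour-↣ : ∀ {a} {E F : EdgeSet a} (s : Vtx a ↣ Vtx a) → Preserves E F (Injection.to s) →
  ∀ v → Neighbour E v ↣ Neighbour F (Injection.to s v)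
neighbour-↣ {E = E} s hom v = mk↣ {to = λ (u , vu) → to u , hom v u vu} injective
  where
    open Injection s using (to)
    injective : ∀ {x y : Neighbour E v} → (to (proj₁ x) , _) ≡ (to (proj₁ y) , _) → x ≡ y
    injective eq = Neighbour-≡ {E = E} {v} (Injection.injective s (cong proj₁ eq))

HasDegree : ∀ {a} → EdgeSet a → Vtx a → ℕ → Set
HasDegree E v d = (Fin d ↣ Neighbour E v) × (Neighbour E v ↣ Fin d)

degree-≤ : ∀ {a} {E F : EdgeSet a} (s : Vtx a ↣ Vtx a) (hom : Preserves E F (Injection.to s)) →
  ∀ {v d d′} → HasDegree E v d → HasDegree F (Injection.to s v) d′ → d ≤ d′
degree-≤ s hom {v} (atLeast , _) (_ , atMost) =
  injective⇒≤ (Injection.injective (atMost ↣-∘ (neighbour-↣ s hom v ↣-∘ atLeast)))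

swap↣ : ∀ {a} → Vtx a ↣ Vtx a
swap↣ = ↔⇒↣ swap-↔

HasDegree-swap : ∀ {a} {E F : EdgeSet a} → Preserves E F swap → Preserves F E swap →
  ∀ {v d} → HasDegree E v d → HasDegree F (swap v) d
HasDegree-swap E→F F→E {inj₁ i} (atLeast , atMost) =
  neighbour-↣ swap↣ E→F (inj₁ i) ↣-∘ atLeast , atMost ↣-∘ neighbour-↣ swap↣ F→E (inj₂ i)
HasDegree-swap E→F F→E {inj₂ j} (atLeast , atMost) =
  neighbour-↣ swap↣ E→F (inj₂ j) ↣-∘ atLeast , atMost ↣-∘ neighbour-↣ swap↣ F→E (inj₁ j)

mirror : ∀ {a} → EdgeSet a → EdgeSet a
mirror F i j = F j i

swap-to-mirror : ∀ {a} {F : EdgeSet a} → Preserves F (mirror F) swap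
swap-to-mirror (inj₁ _) (inj₂ _) uv = uv
swap-to-mirror (inj₂ _) (inj₁ _) uv = uv

swap-from-mirror : ∀ {a} {F : EdgeSet a} → Preserves (mirror F) F swap
swap-from-mirror (inj₁ _) (inj₂ _) uv = uv
swap-from-mirror (inj₂ _) (inj₁ _) uv = uv

record HasSortedDegrees {a} (E : EdgeSet a) (p q : Vec ℕ a) : Set where
  field
    left-sorted  : NonIncreasing p
    right-sorted : NonIncreasing q
    left-degree  : ∀ i → HasDegree E (inj₁ i) (at p (toℕ i))
    right-degree : ∀ j → HasDegree E (inj₂ j) (at q (toℕ j))

HasSortedDegrees-mirror : ∀ {a} {F : EdgeSet a} {p q} →
  HasSortedDegrees F p q → HasSortedDegrees (mirror F) q p
HasSortedDegrees-mirror {F = F} degrees = record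
  { left-sorted  = right-sorted
  ; right-sorted = left-sorted
  ; left-degree  = λ j → HasDegree-swap {E = F} swap-to-mirror swap-from-mirror {inj₂ j} (right-degree j)
  ; right-degree = λ i → HasDegree-swap {E = F} swap-to-mirror swap-from-mirror {inj₁ i} (left-degree i)
  }
  where open HasSortedDegrees degrees

descent⇒connected : ∀ {a} {E : EdgeSet a} (rank : Vtx a → ℕ) (root : Vtx a) →
  (∀ v → v ≡ root ⊎ ∃ λ w → Adj E v w × rank w < rank v) → Connected E
descent⇒connected {E = E} rank root descent u v = Reach-trans (toRoot u) (Reach-sym (toRoot v))
  where
    toRoot′ : ∀ bound v → rank v < bound → Reach E v root
    toRoot′ (suc bound) v rank<bound with descent v
    ... | inj₁ refl           = here
    ... | inj₂ (w , vw , w<v) = step vw (toRoot′ bound w (<-≤-trans w<v (s≤s⁻¹ rank<bound)))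
    toRoot : ∀ v → Reach E v root
    toRoot v = toRoot′ (suc (rank v)) v ≤-refl

-- Since a vertex has at most one lower neighbour, the ranks along a walk that never
-- backtracks first strictly decrease and then strictly increase.
module RankedForest {a : ℕ} (E : EdgeSet a) (rank : Vtx a → ℕ)
  (ranks-differ : ∀ {u v} → Adj E u v → rank u < rank v ⊎ rank v < rank u)
  (lower-unique : ∀ {u w w′} → Adj E u w → Adj E u w′ → rank w < rank u → rank w′ < rank u → w ≡ w′)
  where

  NonBacktracking : List (Vtx a) → Set
  NonBacktracking (x ∷ y ∷ z ∷ xs) = x ≢ z × NonBacktracking (y ∷ z ∷ xs)
  NonBacktracking _                = ⊤

  Unique⇒NonBacktracking : ∀ xs → Unique xs → NonBacktracking xs
  Unique⇒NonBacktracking []               _                         = tt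
  Unique⇒NonBacktracking (_ ∷ [])         _                         = tt
  Unique⇒NonBacktracking (_ ∷ _ ∷ [])     _                         = tt
  Unique⇒NonBacktracking (x ∷ y ∷ z ∷ xs) ((_ ∷ x≢z ∷ _) ∷ unique) =
    x≢z , Unique⇒NonBacktracking (y ∷ z ∷ xs) unique

  lastOf : Vtx a → List (Vtx a) → Vtx a
  lastOf y []       = y
  lastOf y (z ∷ zs) = lastOf z zs

  penultimateOf : Vtx a → Vtx a → List (Vtx a) → Vtx a
  penultimateOf x y []       = x
  penultimateOf x y (z ∷ zs) = penultimateOf y z zs

  lastOf-snoc : ∀ y zs w → lastOf y (zs ++ [ w ]) ≡ w
  lastOf-snoc y []       w = refl
  lastOf-snoc y (z ∷ zs) w = lastOf-snoc z zs w

  penultimateOf-snoc : ∀ x y zs w → penultimateOf x y (zs ++ [ w ]) ≡ lastOf y zs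
  penultimateOf-snoc x y []       w = refl
  penultimateOf-snoc x y (z ∷ zs) w = penultimateOf-snoc y z zs w

  All-lastOf : ∀ {P : Vtx a → Set} y zs → All P (y ∷ zs) → P (lastOf y zs)
  All-lastOf y []       (py ∷ _)  = py
  All-lastOf y (z ∷ zs) (_ ∷ pzs) = All-lastOf z zs pzs

  lastStep : ∀ x y zs → Chain E (x ∷ y ∷ zs) → Adj E (penultimateOf x y zs) (lastOf y zs)
  lastStep x y []       (xy , _) = xy
  lastStep x y (z ∷ zs) (_ , ch) = lastStep y z zs ch

  ascent-persists : ∀ x y zs → Chain E (x ∷ y ∷ zs) → NonBacktracking (x ∷ y ∷ zs) →
    rank x < rank y → rank (penultimateOf x y zs) < rank (lastOf y zs) × rank x < rank (lastOf y zs)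
  ascent-persists x y []       _              _          x<y = x<y , x<y
  ascent-persists x y (z ∷ zs) (xy , yz , ch) (x≢z , nb) x<y with ranks-differ yz
  ... | inj₁ y<z = proj₁ rest , <-trans x<y (proj₂ rest)
    where rest = ascent-persists y z zs (yz , ch) nb y<z
  ... | inj₂ z<y = contradiction (lower-unique (Adj-sym {E = E} x y xy) yz x<y z<y) x≢z

  final-descent⇒descent : ∀ x y zs → Chain E (x ∷ y ∷ zs) → NonBacktracking (x ∷ y ∷ zs) →
    rank (lastOf y zs) < rank (penultimateOf x y zs) → rank (lastOf y zs) < rank x
  final-descent⇒descent x y []       _         _  last<pen = last<pen
  final-descent⇒descent x y (z ∷ zs) (xy , ch) nb last<pen with ranks-differ xy
  ... | inj₁ x<y = contradiction (proj₁ (ascent-persists x y (z ∷ zs) (xy , ch) nb x<y)) (<⇒≯ last<pen)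
  ... | inj₂ y<x = <-trans (final-descent⇒descent y z zs ch (proj₂ nb) last<pen) y<x

  closed-walk-backtracks : ∀ x y zs → Chain E (x ∷ y ∷ zs) → NonBacktracking (x ∷ y ∷ zs) →
    lastOf y zs ≡ x → penultimateOf x y zs ≡ y
  closed-walk-backtracks _ y zs walk nb refl with ranks-differ (proj₁ walk)
  ... | inj₁ x<y = contradiction (proj₂ (ascent-persists _ y zs walk nb x<y)) (<-irrefl refl)
  ... | inj₂ y<x with ranks-differ (lastStep _ y zs walk)
  ...   | inj₂ last<pen = contradiction (final-descent⇒descent _ y zs walk nb last<pen) (<-irrefl refl)
  ...   | inj₁ pen<last =
    lower-unique (Adj-sym {E = E} (penultimateOf _ y zs) _ (lastStep _ y zs walk)) (proj₁ walk) pen<last y<x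

  acyclic : Acyclic E
  acyclic v (_ ∷ [])       (s≤s ()) _ _
  acyclic v (v₁ ∷ v₂ ∷ ws) _ (v∉ ∷ v₁∉ ∷ unique) cycle =
    All-lastOf v₂ ws v₁∉ (sym (trans (sym (penultimateOf-snoc v v₁ (v₂ ∷ ws) v))
      (closed-walk-backtracks v v₁ (v₂ ∷ ws ++ [ v ]) cycle nonBacktracking (lastOf-snoc v₁ (v₂ ∷ ws) v))))
    where
      nonBacktracking : NonBacktracking (v ∷ v₁ ∷ v₂ ∷ ws ++ [ v ])
      nonBacktracking = All.head (All.tail v∉) , Unique⇒NonBacktracking (v₁ ∷ v₂ ∷ ws ++ [ v ])
        (AllPairs.++⁺ (v₁∉ ∷ unique) ([] ∷ []) (All.map (λ v≢x → ≢-sym v≢x ∷ []) v∉))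

-- Isomorphisms and the two sides

isLeft : ∀ {a} → Vtx a → Bool
isLeft (inj₁ _) = true
isLeft (inj₂ _) = false

isLeft-swap : ∀ {a} (v : Vtx a) → isLeft (swap v) ≡ not (isLeft v)
isLeft-swap (inj₁ _) = refl
isLeft-swap (inj₂ _) = refl

Adj⇒opposite-sides : ∀ {a} {E : EdgeSet a} u v → Adj E u v → isLeft v ≡ not (isLeft u)
Adj⇒opposite-sides (inj₁ _) (inj₂ _) _ = refl
Adj⇒opposite-sides (inj₂ _) (inj₁ _) _ = refl

PreservesSides : ∀ {a} → (Vtx a → Vtx a) → Set
PreservesSides s = ∀ v → isLeft (s v) ≡ isLeft v

PreservesSides-inverse : ∀ {a} {s t : Vtx a → Vtx a} →
  PreservesSides s → (∀ v → s (t v) ≡ v) → PreservesSides t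
PreservesSides-inverse {t = t} preserves s∘t≡id v =
  trans (sym (preserves (t v))) (cong isLeft (s∘t≡id v))

sideRelation-spreads : ∀ {a} {E F : EdgeSet a} {s : Vtx a → Vtx a} → Preserves E F s →
  (f : Bool → Bool) → (∀ b → f (not b) ≡ not (f b)) →
  ∀ {u v} → Reach E u v → isLeft (s u) ≡ f (isLeft u) → isLeft (s v) ≡ f (isLeft v)
sideRelation-spreads         hom f f-not here                su≡fu = su≡fu
sideRelation-spreads {s = s} hom f f-not (step {u} {w} uw r) su≡fu =
  sideRelation-spreads hom f f-not r (begin
    isLeft (s w)        ≡⟨ Adj⇒opposite-sides (s u) (s w) (hom u w uw) ⟩
    not (isLeft (s u))  ≡⟨ cong not su≡fu ⟩
    not (f (isLeft u))  ≡⟨ sym (f-not (isLeft u)) ⟩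
    f (not (isLeft u))  ≡⟨ cong f (sym (Adj⇒opposite-sides u w uw)) ⟩
    f (isLeft w)        ∎)
  where open ≡-Reasoning

preservesSides⊎swapsSides : ∀ {a} {E F : EdgeSet a} {s : Vtx a → Vtx a} → Connected E → Preserves E F s →
  Vtx a → PreservesSides s ⊎ PreservesSides (swap ∘ s)
preservesSides⊎swapsSides {s = s} connected hom v₀ with isLeft (s v₀) Bool.≟ isLeft v₀
... | yes same  = inj₁ λ v → sideRelation-spreads hom (λ b → b) (λ _ → refl) (connected v₀ v) same
... | no differ = inj₂ λ v → begin
  isLeft (swap (s v))   ≡⟨ isLeft-swap (s v) ⟩
  not (isLeft (s v))    ≡⟨ cong not (flipped v) ⟩
  not (not (isLeft v))  ≡⟨ Bool.not-involutive _ ⟩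
  isLeft v              ∎
  where
    open ≡-Reasoning
    flipped = λ v → sideRelation-spreads hom not (λ _ → refl) (connected v₀ v) (Bool.¬-not differ)

sideIndex : ∀ {a} → Vtx a → Fin a
sideIndex (inj₁ i) = i
sideIndex (inj₂ j) = j

isLeft⇒inj₁ : ∀ {a} (w : Vtx a) → isLeft w ≡ true → w ≡ inj₁ (sideIndex w)
isLeft⇒inj₁ (inj₁ _) _ = refl

isRight⇒inj₂ : ∀ {a} (w : Vtx a) → isLeft w ≡ false → w ≡ inj₂ (sideIndex w)
isRight⇒inj₂ (inj₂ _) _ = refl

sidePreserving⇒dominated : ∀ {a} {E F : EdgeSet a} {p q p′ q′} →
  HasSortedDegrees E p q → HasSortedDegrees F p′ q′ →
  (s : Vtx a ↣ Vtx a) → Preserves E F (Injection.to s) → PreservesSides (Injection.to s) →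
  Dominated p p′ × Dominated q q′
sidePreserving⇒dominated {F = F} {p} {q} {p′} {q′} E-degrees F-degrees s hom preserves =
    dominated-via-injection {v = p} {p′} (left-sorted E-degrees) (left-sorted F-degrees) τ τ-injective p≤p′∘τ
  , dominated-via-injection {v = q} {q′} (right-sorted E-degrees) (right-sorted F-degrees) ρ ρ-injective q≤q′∘ρ
  where
    open HasSortedDegrees
    open Injection s using (to; injective)
    τ ρ : Fin _ → Fin _
    τ i = sideIndex (to (inj₁ i))
    ρ j = sideIndex (to (inj₂ j))
    to-left : ∀ i → to (inj₁ i) ≡ inj₁ (τ i)
    to-left i = isLeft⇒inj₁ _ (preserves (inj₁ i))
    to-right : ∀ j → to (inj₂ j) ≡ inj₂ (ρ j)
    to-right j = isRight⇒inj₂ _ (preserves (inj₂ j))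
    τ-injective : Injective _≡_ _≡_ τ
    τ-injective {x} {y} eq =
      inj₁-injective (injective (trans (to-left x) (trans (cong inj₁ eq) (sym (to-left y)))))
    ρ-injective : Injective _≡_ _≡_ ρ
    ρ-injective {x} {y} eq =
      inj₂-injective (injective (trans (to-right x) (trans (cong inj₂ eq) (sym (to-right y)))))
    p≤p′∘τ : ∀ i → at p (toℕ i) ≤ at p′ (toℕ (τ i))
    p≤p′∘τ i = degree-≤ s hom (left-degree E-degrees i)
      (subst (λ w → HasDegree F w (at p′ (toℕ (τ i)))) (sym (to-left i)) (left-degree F-degrees (τ i)))
    q≤q′∘ρ : ∀ j → at q (toℕ j) ≤ at q′ (toℕ (ρ j))
    q≤q′∘ρ j = degree-≤ s hom (right-degree E-degrees j)
      (subst (λ w → HasDegree F w (at q′ (toℕ (ρ j)))) (sym (to-right j)) (right-degree F-degrees (ρ j)))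

Unordered≡ : ∀ {A : Set} → A × A → A × A → Set
Unordered≡ (x , y) (x′ , y′) = (x ≡ x′ × y ≡ y′) ⊎ (x ≡ y′ × y ≡ x′)

isomorphic⇒same-sortedDegrees : ∀ {n} (T U : SpanningTree (suc n)) {p q p′ q′} →
  HasSortedDegrees (proj₁ T) p q → HasSortedDegrees (proj₁ U) p′ q′ → Isomorphic T U →
  Unordered≡ (p , q) (p′ , q′)
isomorphic⇒same-sortedDegrees {n} (E , E-tree) (F , _) E-degrees F-degrees (σ , adj) =
  [ preserving , swapping ]′ (preservesSides⊎swapsSides (proj₁ E-tree) forward (inj₁ zero))
  where
    open Inverse σ using (to; from; strictlyInverseˡ)
    forward : Preserves E F to
    forward u v = proj₁ (adj u v)
    backward : Preserves F E from
    backward u v uv = proj₂ (adj (from u) (from v))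
      (subst₂ (Adj F) (sym (strictlyInverseˡ u)) (sym (strictlyInverseˡ v)) uv)
    both-antisym : ∀ {x y x′ y′ : Vec ℕ (suc n)} →
      Dominated x x′ × Dominated y y′ → Dominated x′ x × Dominated y′ y → x ≡ x′ × y ≡ y′
    both-antisym (x≤x′ , y≤y′) (x′≤x , y′≤y) =
      Dominated-antisym x≤x′ x′≤x , Dominated-antisym y≤y′ y′≤y
    preserving : PreservesSides to → _
    preserving preserves = inj₁ (both-antisym
      (sidePreserving⇒dominated E-degrees F-degrees (↔⇒↣ σ) forward preserves)
      (sidePreserving⇒dominated F-degrees E-degrees (↔⇒↣ (↔-sym σ)) backward
        (PreservesSides-inverse preserves strictlyInverseˡ)))
    swapping : PreservesSides (swap ∘ to) → _
    swapping swaps = inj₂ (both-antisym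
      (sidePreserving⇒dominated E-degrees (HasSortedDegrees-mirror F-degrees) (↔⇒↣ (swap-↔ ↔-∘ σ))
        (λ u v → swap-to-mirror (to u) (to v) ∘ forward u v) swaps)
      (sidePreserving⇒dominated (HasSortedDegrees-mirror F-degrees) E-degrees (↔⇒↣ (↔-sym σ ↔-∘ swap-↔))
        (λ u v → backward (swap u) (swap v) ∘ swap-from-mirror u v)
        (PreservesSides-inverse swaps λ v → trans (cong swap (strictlyInverseˡ (swap v))) (swap-involutive v))))

-- The tree of a pair of partitions

data Link {a} (p q : Vec ℕ a) (i j : ℕ) : Set where
  roots      : i ≡ 0 → j ≡ 0 → Link p q i j
  rightChild : offset p i < j → j ≤ offset p (suc i) → Link p q i j
  leftChild  : offset q j < i → i ≤ offset q (suc j) → Link p q i j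

Link-swap : ∀ {a} {p q : Vec ℕ a} {i j} → Link p q i j → Link q p j i
Link-swap (roots i≡0 j≡0)          = roots j≡0 i≡0
Link-swap (rightChild below above) = leftChild below above
Link-swap (leftChild below above)  = rightChild below above

link? : ∀ {a} (p q : Vec ℕ a) i j → Dec (Link p q i j)
link? p q i j = map′ fromCases toCases
  (   (i ≟ 0 ×-dec j ≟ 0)
  ⊎-dec (offset p i <? j ×-dec j ≤? offset p (suc i))
  ⊎-dec (offset q j <? i ×-dec i ≤? offset q (suc j)))
  where
    fromCases : _ → Link p q i j
    fromCases (inj₁ (i≡0 , j≡0))            = roots i≡0 j≡0
    fromCases (inj₂ (inj₁ (below , above))) = rightChild below above
    fromCases (inj₂ (inj₂ (below , above))) = leftChild below above
    toCases : Link p q i j → _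
    toCases (roots i≡0 j≡0)          = inj₁ (i≡0 , j≡0)
    toCases (rightChild below above) = inj₂ (inj₁ (below , above))
    toCases (leftChild below above)  = inj₂ (inj₂ (below , above))

tree : ∀ {a} → Vec ℕ a → Vec ℕ a → EdgeSet a
tree p q i j = isYes (link? p q (toℕ i) (toℕ j))

Adj⇒Link : ∀ {a} {p q : Vec ℕ a} {i j} → Adj (tree p q) (inj₁ i) (inj₂ j) → Link p q (toℕ i) (toℕ j)
Adj⇒Link {p = p} {q} {i} {j} = toWitness {a? = link? p q (toℕ i) (toℕ j)}

Link⇒Adj : ∀ {a} {p q : Vec ℕ a} {i j} → Link p q (toℕ i) (toℕ j) → Adj (tree p q) (inj₁ i) (inj₂ j)
Link⇒Adj {p = p} {q} {i} {j} = fromWitness {a? = link? p q (toℕ i) (toℕ j)}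

Link⇒Adjʳ : ∀ {a} {p q : Vec ℕ a} {i j} (j<a : j < a) →
  Link p q (toℕ i) j → Adj (tree p q) (inj₁ i) (inj₂ (fromℕ< j<a))
Link⇒Adjʳ {p = p} {q} {i} j<a = Link⇒Adj ∘ subst (Link p q (toℕ i)) (sym (toℕ-fromℕ< j<a))

Link⇒Adjˡ : ∀ {a} {p q : Vec ℕ a} {i j} (i<a : i < a) →
  Link p q i (toℕ j) → Adj (tree p q) (inj₁ (fromℕ< i<a)) (inj₂ j)
Link⇒Adjˡ {p = p} {q} {j = j} i<a = Link⇒Adj ∘ subst (λ k → Link p q k (toℕ j)) (sym (toℕ-fromℕ< i<a))

swap-preserves-tree : ∀ {a} {p q : Vec ℕ a} → Preserves (tree p q) (tree q p) swap
swap-preserves-tree (inj₁ i) (inj₂ j) uv = Link⇒Adj (Link-swap (Adj⇒Link uv))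
swap-preserves-tree (inj₂ j) (inj₁ i) uv = Link⇒Adj (Link-swap (Adj⇒Link uv))

Link-below-offset-unique : ∀ {a} {p q : Vec ℕ a} {i j j′} → Link p q i j → Link p q i j′ →
  j ≤ offset p i → j′ ≤ offset p i → j ≡ j′
Link-below-offset-unique (rightChild below _) _ j≤offset _  = contradiction j≤offset (<⇒≱ below)
Link-below-offset-unique _ (rightChild below _) _ j′≤offset = contradiction j′≤offset (<⇒≱ below)
Link-below-offset-unique (roots _ j≡0)       (roots _ j′≡0)      _ _ = trans j≡0 (sym j′≡0)
Link-below-offset-unique (roots refl _)      (leftChild below _) _ _ = contradiction below n≮0
Link-below-offset-unique (leftChild below _) (roots refl _)      _ _ = contradiction below n≮0
Link-below-offset-unique {q = q} (leftChild below above) (leftChild below′ above′) _ _ =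
  offset-interval-unique q below above below′ above′

parent : ∀ {n} {p q : Vec ℕ (suc n)} →
  IsPartition (suc n) (2 * suc n ∸ 1) p → IsPartition (suc n) (2 * suc n ∸ 1) q →
  ∀ {i} → i < suc n → ∃ λ j → j < suc n × j ≤ offset p i × Link p q i j × (j < i ⊎ (i ≡ 0 × j ≡ 0))
parent p-part q-part {zero} _ = 0 , z<s , z≤n , roots refl refl , inj₂ (refl , refl)
parent {q = q} p-part q-part {suc i} i<a
  with offset-interval q z<s (subst (suc i ≤_) (sym (offset-total q-part)) (s≤s⁻¹ i<a))
... | j , j<a , below , above =
  j , j<a , ≤-trans (<⇒≤ j<i) (index≤offset p-part i<a) , leftChild below above , inj₁ j<i
  where j<i = ≤-<-trans (index≤offset q-part j<a) below

rank : ∀ {a} → Vtx a → ℕ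
rank (inj₁ i) = toℕ i + toℕ i
rank (inj₂ j) = suc (toℕ j + toℕ j)

≤⇒double<odd : ∀ {m n} → m ≤ n → m + m < suc (n + n)
≤⇒double<odd m≤n = s≤s (+-mono-≤ m≤n m≤n)

<⇒odd<double : ∀ {m n} → n < m → suc (n + n) < m + m
<⇒odd<double {m} {n} n<m = subst (_≤ m + m) (cong suc (+-suc n n)) (+-mono-≤ n<m n<m)

double<odd⇒≤ : ∀ {m n} → m + m < suc (n + n) → m ≤ n
double<odd⇒≤ lt = ≮⇒≥ (λ n<m → <-asym lt (<⇒odd<double n<m))

odd<double⇒< : ∀ {m n} → suc (n + n) < m + m → n < m
odd<double⇒< lt = ≰⇒> (λ m≤n → <-asym lt (≤⇒double<odd m≤n))

module TreeStructure {n : ℕ} {p q : Vec ℕ (suc n)}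
  (p-part : IsPartition (suc n) (2 * suc n ∸ 1) p) (q-part : IsPartition (suc n) (2 * suc n ∸ 1) q) where

  ranks-differ : ∀ {u v} → Adj (tree p q) u v → rank u < rank v ⊎ rank v < rank u
  ranks-differ {inj₁ i} {inj₂ j} _ with toℕ i ≤? toℕ j
  ... | yes i≤j = inj₁ (≤⇒double<odd i≤j)
  ... | no  i≰j = inj₂ (<⇒odd<double (≰⇒> i≰j))
  ranks-differ {inj₂ j} {inj₁ i} _ with toℕ i ≤? toℕ j
  ... | yes i≤j = inj₂ (≤⇒double<odd i≤j)
  ... | no  i≰j = inj₁ (<⇒odd<double (≰⇒> i≰j))

  lower-unique : ∀ {u w w′} → Adj (tree p q) u w → Adj (tree p q) u w′ →
    rank w < rank u → rank w′ < rank u → w ≡ w′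
  lower-unique {inj₁ i} {inj₂ j} {inj₂ j′} ij ij′ j<i j′<i = cong inj₂ (toℕ-injective
    (Link-below-offset-unique (Adj⇒Link ij) (Adj⇒Link ij′)
      (below (odd<double⇒< j<i)) (below (odd<double⇒< j′<i))))
    where
      below : ∀ {k} → k < toℕ i → k ≤ offset p (toℕ i)
      below k<i = ≤-trans (<⇒≤ k<i) (index≤offset p-part (toℕ<n i))
  lower-unique {inj₂ j} {inj₁ i} {inj₁ i′} ji i′j i<j i′<j = cong inj₁ (toℕ-injective
    (Link-below-offset-unique (Link-swap (Adj⇒Link ji)) (Link-swap (Adj⇒Link i′j))
      (below (double<odd⇒≤ i<j)) (below (double<odd⇒≤ i′<j))))
    where
      below : ∀ {k} → k ≤ toℕ j → k ≤ offset q (toℕ j)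
      below k≤j = ≤-trans k≤j (index≤offset q-part (toℕ<n j))

  descent : ∀ v → v ≡ inj₁ zero ⊎ ∃ λ w → Adj (tree p q) v w × rank w < rank v
  descent (inj₁ zero) = inj₁ refl
  descent (inj₁ (suc i)) with parent p-part q-part (toℕ<n (suc i))
  ... | j , j<a , _ , link , inj₁ j<i = inj₂
    (inj₂ (fromℕ< j<a) , Link⇒Adjʳ j<a link
    , subst (λ k → suc (k + k) < _) (sym (toℕ-fromℕ< j<a)) (<⇒odd<double j<i))
  descent (inj₂ j) with parent q-part p-part (toℕ<n j)
  ... | i , i<a , _ , link , i<j⊎roots = inj₂
    (inj₁ (fromℕ< i<a) , Link⇒Adjˡ i<a (Link-swap link)
    , subst (λ k → k + k < _) (sym (toℕ-fromℕ< i<a)) (≤⇒double<odd (i≤j i<j⊎roots)))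
    where
      i≤j : ∀ {i j} → i < j ⊎ (j ≡ 0 × i ≡ 0) → i ≤ j
      i≤j (inj₁ i<j)        = <⇒≤ i<j
      i≤j (inj₂ (_ , refl)) = z≤n

  isTree : IsTree (tree p q)
  isTree = descent⇒connected rank (inj₁ zero) descent
         , RankedForest.acyclic (tree p q) rank
             (λ {u v} → ranks-differ {u} {v}) (λ {u w w′} → lower-unique {u} {w} {w′})

  offset≤n : ∀ {k} → k ≤ suc n → offset p k ≤ n
  offset≤n {k} k≤a = subst (offset p k ≤_) (offset-total p-part) (offset-mono p k≤a)

  Link-above-offset : ∀ {i j} → i < suc n → j < suc n → Link p q i j → offset p i < j → j ≤ offset p (suc i)
  Link-above-offset i<a j<a (roots _ refl)       offset<j = contradiction offset<j n≮0
  Link-above-offset i<a j<a (rightChild _ above) _        = above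
  Link-above-offset i<a j<a (leftChild below _)  offset<j = contradiction
    (≤-<-trans (index≤offset q-part j<a) (<-≤-trans below (index≤offset p-part i<a))) (<⇒≯ offset<j)

  left-degree-≥ : ∀ i → Fin (at p (toℕ i)) ↣ Neighbour (tree p q) (inj₁ i)
  left-degree-≥ i with parent p-part q-part (toℕ<n i)
  ... | j₀ , j₀<a , j₀≤C , link₀ , _ = mk↣ {to = neighbour} injective
    where
      C = offset p (toℕ i)
      index : ℕ → ℕ
      index zero    = j₀
      index (suc x) = C + suc x
      index-injective : ∀ {x y} → index x ≡ index y → x ≡ y
      index-injective {zero}  {zero}  _  = refl
      index-injective {zero}  {suc y} eq = contradiction (subst (_≤ C) eq j₀≤C) (<⇒≱ (m<m+n C z<s))
      index-injective {suc x} {zero}  eq = contradiction (subst (_≤ C) (sym eq) j₀≤C) (<⇒≱ (m<m+n C z<s))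
      index-injective {suc x} {suc y} eq = +-cancelˡ-≡ C _ _ eq
      child-above : ∀ {x} → suc x < at p (toℕ i) → C + suc x ≤ offset p (suc (toℕ i))
      child-above sx<d = subst (C + _ ≤_) (sym (offset-suc p (toℕ i))) (+-monoʳ-≤ C (∸-monoˡ-≤ 1 sx<d))
      index-valid : ∀ x → x < at p (toℕ i) → index x < suc n × Link p q (toℕ i) (index x)
      index-valid zero    _    = j₀<a , link₀
      index-valid (suc x) sx<d = s≤s (≤-trans (child-above sx<d) (offset≤n (toℕ<n i)))
                               , rightChild (m<m+n C z<s) (child-above sx<d)
      neighbour : Fin (at p (toℕ i)) → Neighbour (tree p q) (inj₁ i)
      neighbour x = inj₂ (fromℕ< (proj₁ valid)) , Link⇒Adjʳ (proj₁ valid) (proj₂ valid)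
        where valid = index-valid (toℕ x) (toℕ<n x)
      injective : Injective _≡_ _≡_ neighbour
      injective eq = toℕ-injective (index-injective (fromℕ<-injective _ _ _ _ (inj₂-injective (cong proj₁ eq))))

  left-degree-≤ : ∀ i → Neighbour (tree p q) (inj₁ i) ↣ Fin (at p (toℕ i))
  left-degree-≤ i = mk↣ {to = position} injective
    where
      C = offset p (toℕ i)
      1≤d = IsPartition.positive p-part (toℕ i) (toℕ<n i)
      position-bound : ∀ {j} → j < suc n → Link p q (toℕ i) j → j ∸ C < at p (toℕ i)
      position-bound {j} j<a link with j ≤? C
      ... | yes j≤C = subst (_< at p (toℕ i)) (sym (m≤n⇒m∸n≡0 j≤C)) 1≤d
      ... | no  j≰C = ≤-<-trans (m≤n+o⇒m∸n≤o j C j≤C+d-1) (d-1<d 1≤d)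
        where
          j≤C+d-1 = subst (j ≤_) (offset-suc p (toℕ i)) (Link-above-offset (toℕ<n i) j<a link (≰⇒> j≰C))
          d-1<d : ∀ {d} → 1 ≤ d → d ∸ 1 < d
          d-1<d {suc d} _ = ≤-refl
      position : Neighbour (tree p q) (inj₁ i) → Fin (at p (toℕ i))
      position (inj₂ j , ij) = fromℕ< (position-bound (toℕ<n j) (Adj⇒Link ij))
      shift-injective : ∀ {j j′} → Link p q (toℕ i) j → Link p q (toℕ i) j′ →
        j ∸ C ≡ j′ ∸ C → j ≡ j′
      shift-injective {j} {j′} link link′ eq with j ≤? C | j′ ≤? C
      ... | yes j≤C | yes j′≤C = Link-below-offset-unique link link′ j≤C j′≤C
      ... | no  j≰C | no  j′≰C = ∸-cancelʳ-≡ (<⇒≤ (≰⇒> j≰C)) (<⇒≤ (≰⇒> j′≰C)) eq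
      ... | yes j≤C | no  j′≰C =
        contradiction (trans (sym eq) (m≤n⇒m∸n≡0 j≤C)) (>⇒≢ (m<n⇒0<n∸m (≰⇒> j′≰C)))
      ... | no  j≰C | yes j′≤C =
        contradiction (trans eq (m≤n⇒m∸n≡0 j′≤C)) (>⇒≢ (m<n⇒0<n∸m (≰⇒> j≰C)))
      injective : Injective _≡_ _≡_ position
      injective {inj₂ j , ij} {inj₂ j′ , ij′} eq = Neighbour-≡ {E = tree p q} {inj₁ i}
        (cong inj₂ (toℕ-injective (shift-injective (Adj⇒Link ij) (Adj⇒Link ij′) (fromℕ<-injective _ _ _ _ eq))))

tree-sortedDegrees : ∀ {n} {p q : Vec ℕ (suc n)} →
  IsPartition (suc n) (2 * suc n ∸ 1) p → IsPartition (suc n) (2 * suc n ∸ 1) q →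
  HasSortedDegrees (tree p q) p q
tree-sortedDegrees {p = p} {q} p-part q-part = record
  { left-sorted  = IsPartition.nonIncreasing p-part
  ; right-sorted = IsPartition.nonIncreasing q-part
  ; left-degree  = λ i → left-degree-≥ i , left-degree-≤ i
  ; right-degree = λ j → HasDegree-swap {E = tree q p} swap-preserves-tree swap-preserves-tree {inj₁ j}
                           (Mirror.left-degree-≥ j , Mirror.left-degree-≤ j)
  }
  where
    open TreeStructure p-part q-part
    module Mirror = TreeStructure q-part p-part

-- Enumerating partitions and unordered pairs

isPartitionᵇ-sound : ∀ {k m} (v : Vec ℕ k) → T (isPartitionᵇ k m v) → IsPartition k m v
isPartitionᵇ-sound v holds = record
  { nonIncreasing = nonIncreasing v desc
  ; positive      = positive v pos
  ; sum≡          = ≡ᵇ⇒≡ _ _ sum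
  }
  where
    split : ∀ {x y} → T (x ∧ y) → T x × T y
    split = Equivalence.to Bool.T-∧
    desc = proj₁ (split {nonIncreasingᵇ v} holds)
    rest = proj₂ (split {nonIncreasingᵇ v} holds)
    pos  = proj₁ (split {allPositiveᵇ v} rest)
    sum  = proj₂ (split {allPositiveᵇ v} rest)
    nonIncreasing : ∀ {k} (v : Vec ℕ k) → T (nonIncreasingᵇ v) → NonIncreasing v
    nonIncreasing []           _ _       = z≤n
    nonIncreasing (x ∷ [])     _ _       = z≤n
    nonIncreasing (x ∷ y ∷ xs) h zero    = ≤ᵇ⇒≤ y x (proj₁ (split h))
    nonIncreasing (x ∷ y ∷ xs) h (suc i) = nonIncreasing (y ∷ xs) (proj₂ (split h)) i
    positive : ∀ {k} (v : Vec ℕ k) → T (allPositiveᵇ v) → ∀ i → i < k → 1 ≤ at v i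
    positive (x ∷ xs) h zero    _   = ≤ᵇ⇒≤ 1 x (proj₁ (split h))
    positive (x ∷ xs) h (suc i) i<k = positive xs (proj₂ (split h)) i (s≤s⁻¹ i<k)

concatMap-map≡cartesianProductWith : ∀ {A B C : Set} (f : A → B → C) xs ys →
  concatMap (λ x → List.map (f x) ys) xs ≡ cartesianProductWith f xs ys
concatMap-map≡cartesianProductWith f []       ys = refl
concatMap-map≡cartesianProductWith f (x ∷ xs) ys =
  cong (List.map (f x) ys ++_) (concatMap-map≡cartesianProductWith f xs ys)

vecsUpTo-unique : ∀ k n → Unique (vecsUpTo k n)
vecsUpTo-unique zero    n = [] ∷ []
vecsUpTo-unique (suc k) n =
  subst Unique (sym (concatMap-map≡cartesianProductWith _∷_ (upTo (suc n)) (vecsUpTo k n)))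
    (Unique.cartesianProductWith⁺ _∷_ ∷-injective (Unique.upTo⁺ (suc n)) (vecsUpTo-unique k n))

lookup-injective : ∀ {A : Set} {xs : List A} → Unique xs → Injective _≡_ _≡_ (List.lookup xs)
lookup-injective {xs = _ ∷ _} _            {zero}  {zero}  _  = refl
lookup-injective {xs = _ ∷ _} (x∉ ∷ _)     {zero}  {suc j} eq = contradiction eq (All.lookup x∉ (∈-lookup j))
lookup-injective {xs = _ ∷ _} (x∉ ∷ _)     {suc i} {zero}  eq = contradiction (sym eq) (All.lookup x∉ (∈-lookup i))
lookup-injective {xs = _ ∷ _} (_ ∷ unique) {suc i} {suc j} eq = cong suc (lookup-injective unique eq)

partition : ∀ k m → Fin (P k m) → Vec ℕ k
partition k m = List.lookup (filterᵇ (isPartitionᵇ k m) (vecsUpTo k m))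

partition-sound : ∀ k m x → IsPartition k m (partition k m x)
partition-sound k m x = isPartitionᵇ-sound _
  (All.lookup (all-filter (T? ∘ isPartitionᵇ k m) (vecsUpTo k m)) (∈-lookup x))

partition-injective : ∀ k m → Injective _≡_ _≡_ (partition k m)
partition-injective k m = lookup-injective (Unique.filter⁺ (T? ∘ isPartitionᵇ k m) (vecsUpTo-unique k m))

Unordered≡-injective : ∀ {A B : Set} {f : A → B} → Injective _≡_ _≡_ f →
  ∀ {x y x′ y′} → Unordered≡ (f x , f y) (f x′ , f y′) → Unordered≡ (x , y) (x′ , y′)
Unordered≡-injective f-injective (inj₁ (e₁ , e₂)) = inj₁ (f-injective e₁ , f-injective e₂)
Unordered≡-injective f-injective (inj₂ (e₁ , e₂)) = inj₂ (f-injective e₁ , f-injective e₂)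

triangle : ℕ → ℕ
triangle zero    = 0
triangle (suc r) = suc r + triangle r

triangle≡ : ∀ r → r * (r + 1) / 2 ≡ triangle r
triangle≡ r = trans (cong (_/ 2) (sym (double r))) (m*n/n≡m (triangle r) 2)
  where
    open +-*-Solver
    double : ∀ r → triangle r * 2 ≡ r * (r + 1)
    double zero    = refl
    double (suc r) = begin
      (suc r + triangle r) * 2    ≡⟨ *-distribʳ-+ 2 (suc r) (triangle r) ⟩
      suc r * 2 + triangle r * 2  ≡⟨ cong (suc r * 2 +_) (double r) ⟩
      suc r * 2 + r * (r + 1)     ≡⟨ solve 1 (λ r → (con 1 :+ r) :* con 2 :+ r :* (r :+ con 1)
                                                := (con 1 :+ r) :* ((con 1 :+ r) :+ con 1)) refl r ⟩
      suc r * (suc r + 1)         ∎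
      where open ≡-Reasoning

orderedPair : ∀ r → Fin (triangle r) → Fin r × Fin r
orderedPair (suc r) k with splitAt (suc r) k
... | inj₁ i  = i , fromℕ r
... | inj₂ k′ = Product.map inject₁ inject₁ (orderedPair r k′)

orderedPair-ordered : ∀ r k → toℕ (proj₁ (orderedPair r k)) ≤ toℕ (proj₂ (orderedPair r k))
orderedPair-ordered (suc r) k with splitAt (suc r) k
... | inj₁ i  = subst (toℕ i ≤_) (sym (toℕ-fromℕ r)) (s≤s⁻¹ (toℕ<n i))
... | inj₂ k′ = subst₂ _≤_ (sym (toℕ-inject₁ _)) (sym (toℕ-inject₁ _)) (orderedPair-ordered r k′)

splitAt-injective : ∀ m {n} → Injective _≡_ _≡_ (splitAt m {n})
splitAt-injective m {n} {i} {j} eq =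
  trans (sym (join-splitAt m n i)) (trans (cong (join m n) eq) (join-splitAt m n j))

orderedPair-injective : ∀ r → Injective _≡_ _≡_ (orderedPair r)
orderedPair-injective (suc r) {k} {k′} eq with splitAt (suc r) k in split | splitAt (suc r) k′ in split′
... | inj₁ _ | inj₁ _ = splitAt-injective (suc r) (trans split (trans (cong (inj₁ ∘ proj₁) eq) (sym split′)))
... | inj₁ _ | inj₂ _ = contradiction (cong proj₂ eq) fromℕ≢inject₁
... | inj₂ _ | inj₁ _ = contradiction (sym (cong proj₂ eq)) fromℕ≢inject₁
... | inj₂ _ | inj₂ _ = splitAt-injective (suc r) (trans split (trans (cong inj₂ pairs≡) (sym split′)))
  where
    pairs≡ = orderedPair-injective r
      (cong₂ _,_ (inject₁-injective (cong proj₁ eq)) (inject₁-injective (cong proj₂ eq)))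

orderedPair-unordered-injective : ∀ r {k k′} → Unordered≡ (orderedPair r k) (orderedPair r k′) → k ≡ k′
orderedPair-unordered-injective r (inj₁ (i≡i′ , j≡j′)) = orderedPair-injective r (cong₂ _,_ i≡i′ j≡j′)
orderedPair-unordered-injective r {k} {k′} (inj₂ (i≡j′ , j≡i′)) =
  orderedPair-injective r (cong₂ _,_ i≡i′ j≡j′)
  where
    i≡i′ = toℕ-injective (≤-antisym (subst (λ x → _ ≤ toℕ x) j≡i′ (orderedPair-ordered r k))
                                    (subst (λ x → _ ≤ toℕ x) (sym i≡j′) (orderedPair-ordered r k′)))
    j≡j′ = trans j≡i′ (trans (sym i≡i′) i≡j′)

-- The argument works for every a ≥ 1; the hypothesis 2 ≤ a only rules out a = 0.
theorem2p4 : (a : ℕ) → 2 ≤ a →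
    AtLeastIsoClasses a ((P a (2 * a ∸ 1) * (P a (2 * a ∸ 1) + 1)) / 2)
theorem2p4 (suc n) _ = subst (AtLeastIsoClasses a) (sym (triangle≡ r)) (treeAt ∘ orderedPair r , non-isomorphic)
  where
    a = suc n
    m = 2 * a ∸ 1
    r = P a m
    part = partition a m
    sound = partition-sound a m
    treeAt : Fin r × Fin r → SpanningTree a
    treeAt (i , j) = tree (part i) (part j) , TreeStructure.isTree (sound i) (sound j)
    non-isomorphic : ∀ k k′ → Isomorphic (treeAt (orderedPair r k)) (treeAt (orderedPair r k′)) → k ≡ k′
    non-isomorphic k k′ iso = orderedPair-unordered-injective r (Unordered≡-injective (partition-injective a m)
      (isomorphic⇒same-sortedDegrees (treeAt (orderedPair r k)) (treeAt (orderedPair r k′))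
        (tree-sortedDegrees (sound _) (sound _)) (tree-sortedDegrees (sound _) (sound _)) iso))
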